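{- For every integer $k\geq 6$ there exists a (finite, simple, connected) graph $G$ such that $\gamma_{\rm wcon}(G)-\gamma_c(G)=k$.
   Context: All graphs are finite, undirected, simple and connected. A set $D\subseteq V(G)$ is dominating if every vertex of $V(G)-D$ has a neighbour in $D$. $D$ is a connected dominating set if it is dominating and $G[D]$ is connected; $\gamma_c(G)$ is the minimum cardinality of a connected dominating set. A set $X$ is weakly convex if for any two vertices $a,b\in X$ there is a shortest $(a-b)$-path in $G$ (an $(a-b)$-geodesic) all of whose vertices lie in $X$. $\gamma_{\rm wcon}(G)$ is the minimum cardinality of a set that is both weakly convex and dominating. -}

module Defs where

open import Data.Nat using (ℕ; zero; suc; _≤_; _+_)
open import Data.Bool using (Bool; T; not)
open import Data.Fin using (Fin)
open import Data.Fin.Subset using (Subset; _∈_; ∣_∣)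
open import Data.Product using (Σ; ∃; ∃-syntax; _×_; _,_)
open import Data.Sum using (_⊎_)
open import Relation.Binary.PropositionalEquality using (_≡_)

record Graph : Set where
  field
    n     : ℕ
    adj   : Fin n → Fin n → Bool
    sym   : ∀ u v → adj u v ≡ adj v u
    irr   : ∀ v → T (not (adj v v))

open Graph public

Adj : (G : Graph) → Fin (n G) → Fin (n G) → Set
Adj G u v = T (adj G u v)

data WalkIn (G : Graph) (P : Fin (n G) → Set) : Fin (n G) → Fin (n G) → ℕ → Set where
  here : ∀ {a} → P a → WalkIn G P a a zero
  step : ∀ {a b c ℓ} → P a → Adj G a b → WalkIn G P b c ℓ → WalkIn G P a c (suc ℓ)

Everywhere : (G : Graph) → Fin (n G) → Set
Everywhere G _ = Fin 1

Walk : (G : Graph) → Fin (n G) → Fin (n G) → ℕ → Set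
Walk G = WalkIn G (Everywhere G)

-- G is connected (and has at least one vertex)
Connected : Graph → Set
Connected G = Fin (n G) × (∀ a b → ∃[ ℓ ] Walk G a b ℓ)

InducesConnected : (G : Graph) → Subset (n G) → Set
InducesConnected G X = ∀ a b → a ∈ X → b ∈ X → ∃[ ℓ ] WalkIn G (_∈ X) a b ℓ

Dominating : (G : Graph) → Subset (n G) → Set
Dominating G D = ∀ v → v ∈ D ⊎ (∃[ u ] (u ∈ D × Adj G u v))

WeaklyConvex : (G : Graph) → Subset (n G) → Set
WeaklyConvex G X = ∀ a b → a ∈ X → b ∈ X →
  ∃[ ℓ ] (WalkIn G (_∈ X) a b ℓ × (∀ m → Walk G a b m → ℓ ≤ m))

ConnectedDominating : (G : Graph) → Subset (n G) → Set
ConnectedDominating G D = Dominating G D × InducesConnected G D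

WeaklyConvexDominating : (G : Graph) → Subset (n G) → Set
WeaklyConvexDominating G D = Dominating G D × WeaklyConvex G D

IsMinCard : (G : Graph) → (Subset (n G) → Set) → ℕ → Set
IsMinCard G Q m = (∃[ D ] (Q D × ∣ D ∣ ≡ m)) × (∀ D → Q D → m ≤ ∣ D ∣)

IsConnDomNumber : (G : Graph) → ℕ → Set
IsConnDomNumber G = IsMinCard G (ConnectedDominating G)

IsWeaklyConvexDomNumber : (G : Graph) → ℕ → Set
IsWeaklyConvexDomNumber G = IsMinCard G (WeaklyConvexDominating G)

-- Take a path S₀ … S_{k+2}, hang a leaf Lᵢ on every Sᵢ, and for each j < k add a vertex Mⱼ
-- adjacent to Sⱼ and Sⱼ₊₃. Every connected dominating set contains the neighbour Sᵢ of each leaf,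
-- and the path is a connected dominating set, so γ_c = k + 3. Sⱼ and Sⱼ₊₃ are at distance 2 and
-- Mⱼ is their only common neighbour, so a weakly convex dominating set also contains every Mⱼ;
-- conversely the non-leaf vertices form a weakly convex set, because a walk that enters a leaf
-- must return the way it came. Hence γ_wcon = 2k + 3.
module Submission where

open import Defs
open import Data.Nat using (ℕ; zero; suc; _≤_; _+_; z≤n; s≤s)
open import Data.Product using (∃-syntax; _×_; _,_)
open import Data.Nat.Properties using (m≢1+n+m; m≤n⇒m≤1+n; m≤n+m; +-identityʳ; ≤-trans)
  renaming (_≟_ to _≟ℕ_)
open import Data.Bool using (Bool; T)
open import Data.Empty using (⊥-elim)
open import Data.Fin using (Fin; toℕ; inject₁; inject≤; _↑ˡ_; _↑ʳ_; splitAt)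
  renaming (zero to fzero; suc to fsuc)
open import Data.Fin.Properties using (toℕ-inject₁; toℕ-inject≤; toℕ-injective; splitAt-↑ˡ; splitAt-↑ʳ; join-splitAt; any?)
  renaming (_≟_ to _≟F_)
open import Data.Fin.Induction using (<-weakInduction)
open import Data.Fin.Subset using (Subset; inside; outside; _∈_; _∉_; _⊆_; ∣_∣)
open import Data.Fin.Subset.Properties using (_∈?_; p⊆q⇒∣p∣≤∣q∣; ∣⊥∣≡0)
open import Data.Vec using (replicate; _++_; lookup)
open import Data.Vec.Properties using (lookup-++ˡ; lookup-++ʳ; lookup-replicate; lookup⇒[]=; []=⇒lookup)
open import Data.Sum using (_⊎_; inj₁; inj₂; [_,_]′; swap)
open import Function using (_∘_)
open import Function.Bundles using (mk⇔)
open import Relation.Binary using (Decidable)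
open import Relation.Nullary using (¬_; Dec; does; yes; no)
open import Relation.Nullary.Decidable
  using (map′; isYes; T?; _×-dec_; _⊎-dec_; isYes≗does; does-⇔; toWitness; fromWitness; fromWitnessFalse)
open import Relation.Binary.PropositionalEquality
  using (_≡_; _≢_; refl; trans; cong; subst; subst₂; module ≡-Reasoning) renaming (sym to ≡-sym)
import Relation.Unary as U

Reachable : (G : Graph) → (Fin (n G) → Set) → Fin (n G) → Fin (n G) → Set
Reachable G P a b = ∃[ ℓ ] WalkIn G P a b ℓ

HasAtMostOneNeighbour : (G : Graph) → Fin (n G) → Set
HasAtMostOneNeighbour G v = ∀ {u w} → Adj G u v → Adj G w v → u ≡ w

Shortcuts : (G : Graph) → Subset (n G) → Set
Shortcuts G X = ∀ {a b m} → a ∈ X → b ∈ X → Walk G a b m →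
  ∃[ m′ ] (m′ ≤ m × WalkIn G (_∈ X) a b m′)

least-witness : {P : ℕ → Set} → U.Decidable P → ∀ {m} → P m → ∃[ j ] (P j × (∀ {i} → P i → j ≤ i))
least-witness P? {zero} p₀ = 0 , p₀ , λ _ → z≤n
least-witness P? {suc m} pₘ with P? 0
... | yes p₀ = 0 , p₀ , λ _ → z≤n
... | no ¬p₀ with least-witness (P? ∘ suc) pₘ
...   | j , pj , least = suc j , pj , λ { {zero} p₀ → ⊥-elim (¬p₀ p₀) ; {suc i} pᵢ → s≤s (least pᵢ) }

∣⊤++q∣ : ∀ m {n} (q : Subset n) → ∣ replicate m inside ++ q ∣ ≡ m + ∣ q ∣
∣⊤++q∣ zero    q = refl
∣⊤++q∣ (suc m) q = cong suc (∣⊤++q∣ m q)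

∣⊥++q∣ : ∀ m {n} (q : Subset n) → ∣ replicate m outside ++ q ∣ ≡ ∣ q ∣
∣⊥++q∣ zero    q = refl
∣⊥++q∣ (suc m) q = ∣⊥++q∣ m q

module _ {G : Graph} where

  adj-sym : ∀ {u v} → Adj G u v → Adj G v u
  adj-sym {u} {v} = subst T (sym G u v)

  module _ {P : Fin (n G) → Set} where

    walkIn-head : ∀ {a b ℓ} → WalkIn G P a b ℓ → P a
    walkIn-head (here pa)     = pa
    walkIn-head (step pa _ _) = pa

    _++ʷ_ : ∀ {a b c ℓ m} → WalkIn G P a b ℓ → WalkIn G P b c m → WalkIn G P a c (ℓ + m)
    here _        ++ʷ w = w
    step pa ab v  ++ʷ w = step pa ab (v ++ʷ w)

    reachable-trans : ∀ {a b c} → Reachable G P a b → Reachable G P b c → Reachable G P a c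
    reachable-trans (_ , v) (_ , w) = _ , v ++ʷ w

    reachable-sym : ∀ {a b} → Reachable G P a b → Reachable G P b a
    reachable-sym (_ , here pa)       = _ , here pa
    reachable-sym (_ , step pa ab w) =
      reachable-trans (reachable-sym (_ , w)) (_ , step (walkIn-head w) (adj-sym ab) (here pa))

    walkIn-map : ∀ {Q : Fin (n G) → Set} → (∀ {v} → P v → Q v) →
                 ∀ {a b ℓ} → WalkIn G P a b ℓ → WalkIn G Q a b ℓ
    walkIn-map f (here pa)      = here (f pa)
    walkIn-map f (step pa ab w) = step (f pa) ab (walkIn-map f w)

    walkIn? : U.Decidable P → ∀ ℓ a b → Dec (WalkIn G P a b ℓ)
    walkIn? P? zero a b with a ≟F b | P? a
    ... | yes refl | yes pa = yes (here pa)
    ... | yes refl | no ¬pa = no λ { (here pa) → ¬pa pa }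
    ... | no a≢b   | _      = no λ { (here _) → a≢b refl }
    walkIn? P? (suc ℓ) a b with P? a | any? (λ c → T? (adj G a c) ×-dec walkIn? P? ℓ c b)
    ... | yes pa | yes (_ , ac , w) = yes (step pa ac w)
    ... | yes _  | no ¬next         = no λ { (step _ ac w) → ¬next (_ , ac , w) }
    ... | no ¬pa | _                = no λ { (step pa _ _) → ¬pa pa }

  connectedDominating⇒connected : ∀ {D d} → d ∈ D → ConnectedDominating G D → Connected G
  connectedDominating⇒connected {D} {d} _ (dom , conn) = d , λ a b →
    let (u , u∈ , u⇝a) = fromD a ; (w , w∈ , w⇝b) = fromD b ; (_ , u⇝w) = conn u w u∈ w∈ in
    reachable-trans (reachable-sym u⇝a) (reachable-trans (_ , walkIn-map (λ _ → fzero) u⇝w) w⇝b)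
    where
    fromD : ∀ v → ∃[ u ] (u ∈ D × Reachable G (Everywhere G) u v)
    fromD v with dom v
    ... | inj₁ v∈            = v , v∈ , 0 , here fzero
    ... | inj₂ (u , u∈ , uv) = u , u∈ , 1 , step fzero uv (here fzero)

  weaklyConvex⇒inducesConnected : ∀ {X} → WeaklyConvex G X → InducesConnected G X
  weaklyConvex⇒inducesConnected wc a b a∈ b∈ = let (ℓ , w , _) = wc a b a∈ b∈ in ℓ , w

  shortcuts⇒weaklyConvex : ∀ {X} → Connected G → Shortcuts G X → WeaklyConvex G X
  shortcuts⇒weaklyConvex {X} (_ , conn) shortcut a b a∈ b∈ =
    let (_ , walk) = conn a b
        (_ , _ , w) = shortcut a∈ b∈ walk
        (ℓ , geodesic , shortest) = least-witness (λ ℓ → walkIn? (_∈? X) ℓ a b) w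
    in ℓ , geodesic , λ m walk′ →
         let (m′ , m′≤m , w′) = shortcut a∈ b∈ walk′ in ≤-trans (shortest w′) m′≤m

  module _ {X : Subset (n G)} (pendant : ∀ {v} → v ∉ X → HasAtMostOneNeighbour G v) where

    -- A walk leaving X enters a vertex whose only neighbour is where it came from, so the
    -- detour a → c → a can be cut out.
    pendantComplement⇒shortcuts : Shortcuts G X
    pendantComplement⇒shortcuts a∈ b∈ (here _) = 0 , z≤n , here a∈
    pendantComplement⇒shortcuts a∈ b∈ (step {b = c} _ ac w) with c ∈? X
    ... | yes c∈ = let (m′ , m′≤m , w′) = pendantComplement⇒shortcuts c∈ b∈ w in
                   suc m′ , s≤s m′≤m , step a∈ ac w′
    ... | no c∉ = detour b∈ w
      where
      detour : ∀ {m b} → b ∈ X → Walk G c b m → ∃[ m′ ] (m′ ≤ suc m × WalkIn G (_∈ X) _ b m′)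
      detour b∈ (here _) = ⊥-elim (c∉ b∈)
      detour b∈ (step _ cd w′) with pendant c∉ ac (adj-sym cd)
      ... | refl = let (m′ , m′≤m , w″) = pendantComplement⇒shortcuts a∈ b∈ w′ in
                   m′ , m≤n⇒m≤1+n (m≤n⇒m≤1+n m′≤m) , w″

  support-∈ : ∀ {D s l u} → Adj G s l → HasAtMostOneNeighbour G l →
              ConnectedDominating G D → u ∈ D → u ≢ l → s ∈ D
  support-∈ {D} {l = l} {u} sl one (dom , conn) u∈ u≢l with dom l
  ... | inj₂ (w , w∈ , wl) = subst (_∈ D) (one wl sl) w∈
  ... | inj₁ l∈ with conn l u l∈ u∈
  ...   | _ , here _      = ⊥-elim (u≢l refl)
  ...   | _ , step _ lc w = subst (_∈ D) (one (adj-sym lc) sl) (walkIn-head w)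

  midpoint-∈ : ∀ {X a b} → a ≢ b → ¬ Adj G a b → Walk G a b 2 → WeaklyConvex G X →
               a ∈ X → b ∈ X → ∃[ c ] (c ∈ X × Adj G a c × Adj G c b)
  midpoint-∈ {X} a≢b ¬ab walk₂ wc a∈ b∈ =
    let (_ , geodesic , shortest) = wc _ _ a∈ b∈ in middle a≢b ¬ab geodesic (shortest 2 walk₂)
    where
    middle : ∀ {a b ℓ} → a ≢ b → ¬ Adj G a b → WalkIn G (_∈ X) a b ℓ → ℓ ≤ 2 →
             ∃[ c ] (c ∈ X × Adj G a c × Adj G c b)
    middle a≢b _   (here _)                              _ = ⊥-elim (a≢b refl)
    middle _   ¬ab (step _ ab (here _))                  _ = ⊥-elim (¬ab ab)
    middle _   _   (step _ ac (step c∈ cb (here _)))     _ = _ , c∈ , ac , cb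
    middle _   _   (step _ _ (step _ _ (step _ _ _))) (s≤s (s≤s ()))

  least⇒isMinCard : ∀ {Q X} → Q X → (∀ D → Q D → X ⊆ D) → IsMinCard G Q ∣ X ∣
  least⇒isMinCard {X = X} qX least = (X , qX , refl) , λ D qD → p⊆q⇒∣p∣≤∣q∣ (least D qD)

module Construction (k : ℕ) where

  p : ℕ
  p = 3 + k

  data Vertex : Set where
    spine : Fin p → Vertex
    mid   : Fin k → Vertex
    leaf  : Fin p → Vertex

  data Arc : Vertex → Vertex → Set where
    spine-spine : ∀ {i j} → suc (toℕ i) ≡ toℕ j → Arc (spine i) (spine j)
    spine-mid   : ∀ {i j} → toℕ i ≡ toℕ j → Arc (spine i) (mid j)
    mid-spine   : ∀ {j i} → toℕ i ≡ 3 + toℕ j → Arc (mid j) (spine i)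
    spine-leaf  : ∀ {i} → Arc (spine i) (leaf i)

  Edge : Vertex → Vertex → Set
  Edge x y = Arc x y ⊎ Arc y x

  arc? : Decidable Arc
  arc? (spine i) (spine j) = map′ spine-spine (λ { (spine-spine e) → e }) (suc (toℕ i) ≟ℕ toℕ j)
  arc? (spine i) (mid j)   = map′ spine-mid (λ { (spine-mid e) → e }) (toℕ i ≟ℕ toℕ j)
  arc? (mid j)   (spine i) = map′ mid-spine (λ { (mid-spine e) → e }) (toℕ i ≟ℕ 3 + toℕ j)
  arc? (spine i) (leaf j) with i ≟F j
  ... | yes refl = yes spine-leaf
  ... | no i≢j   = no λ { spine-leaf → i≢j refl }
  arc? (mid _)   (mid _)   = no λ ()
  arc? (mid _)   (leaf _)  = no λ ()
  arc? (leaf _)  _         = no λ ()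

  edge? : Decidable Edge
  edge? x y = arc? x y ⊎-dec arc? y x

  edge-irrefl : ∀ {x} → ¬ Edge x x
  edge-irrefl (inj₁ (spine-spine e)) = m≢1+n+m _ {0} (≡-sym e)
  edge-irrefl (inj₂ (spine-spine e)) = m≢1+n+m _ {0} (≡-sym e)

  edge?-sym : ∀ x y → isYes (edge? x y) ≡ isYes (edge? y x)
  edge?-sym x y = begin
    isYes (edge? x y) ≡⟨ isYes≗does (edge? x y) ⟩
    does (edge? x y)  ≡⟨ does-⇔ (mk⇔ swap swap) (edge? x y) (edge? y x) ⟩
    does (edge? y x)  ≡⟨ ≡-sym (isYes≗does (edge? y x)) ⟩
    isYes (edge? y x) ∎
    where open ≡-Reasoning

  N : ℕ
  N = p + (k + p)

  encode : Vertex → Fin N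
  encode (spine i) = i ↑ˡ (k + p)
  encode (mid j)   = p ↑ʳ (j ↑ˡ p)
  encode (leaf i)  = p ↑ʳ (k ↑ʳ i)

  decode : Fin N → Vertex
  decode v = [ spine , [ mid , leaf ]′ ∘ splitAt k ]′ (splitAt p v)

  decode-encode : ∀ x → decode (encode x) ≡ x
  decode-encode (spine i) rewrite splitAt-↑ˡ p i (k + p) = refl
  decode-encode (mid j)   rewrite splitAt-↑ʳ p (k + p) (j ↑ˡ p) | splitAt-↑ˡ k j p = refl
  decode-encode (leaf i)  rewrite splitAt-↑ʳ p (k + p) (k ↑ʳ i) | splitAt-↑ʳ k p i = refl

  encode-decode : ∀ v → encode (decode v) ≡ v
  encode-decode v with splitAt p v | join-splitAt p (k + p) v
  ... | inj₁ i | e = e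
  ... | inj₂ w | e with splitAt k w | join-splitAt k p w
  ...   | inj₁ j | e′ = trans (cong (p ↑ʳ_) e′) e
  ...   | inj₂ i | e′ = trans (cong (p ↑ʳ_) e′) e

  encode-injective : ∀ {x y} → encode x ≡ encode y → x ≡ y
  encode-injective {x} {y} e = trans (≡-sym (decode-encode x)) (trans (cong decode e) (decode-encode y))

  vertex-ind : (P : Fin N → Set) → (∀ x → P (encode x)) → ∀ v → P v
  vertex-ind P h v = subst P (encode-decode v) (h (decode v))

  G : Graph
  G = record
    { n   = N
    ; adj = λ u v → isYes (edge? (decode u) (decode v))
    ; sym = λ u v → edge?-sym (decode u) (decode v)
    ; irr = λ v → fromWitnessFalse edge-irrefl
    }

  edge⇒adj : ∀ {x y} → Edge x y → Adj G (encode x) (encode y)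
  edge⇒adj {x} {y} e = fromWitness (subst₂ Edge (≡-sym (decode-encode x)) (≡-sym (decode-encode y)) e)

  adj⇒edge : ∀ {x y} → Adj G (encode x) (encode y) → Edge x y
  adj⇒edge {x} {y} a = subst₂ Edge (decode-encode x) (decode-encode y) (toWitness a)

  leaf-neighbour : ∀ {x i} → Edge x (leaf i) → x ≡ spine i
  leaf-neighbour (inj₁ spine-leaf) = refl
  leaf-neighbour (inj₂ ())

  leaf≁leaf : ∀ {i j} → ¬ Edge (leaf i) (leaf j)
  leaf≁leaf (inj₁ ())
  leaf≁leaf (inj₂ ())

  -- Every contradiction below is an equation n ≡ suc (d + n).
  module _ {i i′ : Fin p} (i′≡3+i : toℕ i′ ≡ 3 + toℕ i) where

    spine-3apart-≢ : spine i ≢ spine i′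
    spine-3apart-≢ refl = m≢1+n+m _ {2} i′≡3+i

    spine-3apart-≁ : ¬ Edge (spine i) (spine i′)
    spine-3apart-≁ (inj₁ (spine-spine e)) = m≢1+n+m _ {1} (trans e i′≡3+i)
    spine-3apart-≁ (inj₂ (spine-spine e)) = m≢1+n+m _ {3} (trans (≡-sym e) (cong suc i′≡3+i))

    spine-3apart-commonNeighbour : ∀ {x} → Edge (spine i) x → Edge x (spine i′) →
                                   ∃[ j ] (x ≡ mid j × toℕ i ≡ toℕ j)
    spine-3apart-commonNeighbour (inj₁ (spine-spine e₁)) (inj₁ (spine-spine e₂)) =
      ⊥-elim (m≢1+n+m _ {0} (trans (cong suc e₁) (trans e₂ i′≡3+i)))
    spine-3apart-commonNeighbour (inj₁ (spine-spine e₁)) (inj₂ (spine-spine e₂)) =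
      ⊥-elim (m≢1+n+m _ {2} (trans e₁ (trans (≡-sym e₂) (cong suc i′≡3+i))))
    spine-3apart-commonNeighbour (inj₂ (spine-spine e₁)) (inj₁ (spine-spine e₂)) =
      ⊥-elim (m≢1+n+m _ {2} (trans (≡-sym e₁) (trans e₂ i′≡3+i)))
    spine-3apart-commonNeighbour (inj₂ (spine-spine e₁)) (inj₂ (spine-spine e₂)) =
      ⊥-elim (m≢1+n+m _ {4} (trans (≡-sym e₁) (cong suc (trans (≡-sym e₂) (cong suc i′≡3+i)))))
    spine-3apart-commonNeighbour (inj₁ (spine-mid e₁)) _ = _ , refl , e₁
    spine-3apart-commonNeighbour (inj₂ (mid-spine e₁)) (inj₁ (mid-spine e₂)) =
      ⊥-elim (m≢1+n+m _ {2} (trans e₁ (trans (≡-sym e₂) i′≡3+i)))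
    spine-3apart-commonNeighbour (inj₂ (mid-spine e₁)) (inj₂ (spine-mid e₂)) =
      ⊥-elim (m≢1+n+m _ {5} (trans e₁ (cong (3 +_) (trans (≡-sym e₂) i′≡3+i))))
    spine-3apart-commonNeighbour (inj₁ spine-leaf) (inj₂ spine-leaf) = ⊥-elim (m≢1+n+m _ {2} i′≡3+i)

  lo hi : Fin k → Fin p
  lo j = inject≤ j (m≤n+m k 3)
  hi j = fsuc (fsuc (fsuc j))

  hi≡3+lo : ∀ j → toℕ (hi j) ≡ 3 + toℕ (lo j)
  hi≡3+lo j = cong (3 +_) (≡-sym (toℕ-inject≤ j _))

  spine-path : ∀ {P} → (∀ i → P (encode (spine i))) →
               ∀ i → Reachable G P (encode (spine i)) (encode (spine fzero))
  spine-path {P} onSpine =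
    <-weakInduction (λ i → Reachable G P (encode (spine i)) (encode (spine fzero)))
      (_ , here (onSpine fzero))
      (λ i → reachable-trans
               (_ , step (onSpine (fsuc i)) (edge⇒adj (inj₂ (spine-spine (cong suc (toℕ-inject₁ i)))))
                      (here (onSpine (inject₁ i)))))

  blocks : (s m l : Bool) → Subset N
  blocks s m l = replicate p s ++ (replicate k m ++ replicate p l)

  flag : (s m l : Bool) → Vertex → Bool
  flag s m l (spine _) = s
  flag s m l (mid _)   = m
  flag s m l (leaf _)  = l

  lookup-blocks : ∀ s m l x → lookup (blocks s m l) (encode x) ≡ flag s m l x
  lookup-blocks s m l (spine i) = trans (lookup-++ˡ (replicate p s) _ i) (lookup-replicate i s)
  lookup-blocks s m l (mid j)   = begin
    lookup (blocks s m l) (p ↑ʳ (j ↑ˡ p))               ≡⟨ lookup-++ʳ (replicate p s) _ (j ↑ˡ p) ⟩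
    lookup (replicate k m ++ replicate p l) (j ↑ˡ p)     ≡⟨ lookup-++ˡ (replicate k m) _ j ⟩
    lookup (replicate k m) j                             ≡⟨ lookup-replicate j m ⟩
    m                                                    ∎
    where open ≡-Reasoning
  lookup-blocks s m l (leaf i)  = begin
    lookup (blocks s m l) (p ↑ʳ (k ↑ʳ i))               ≡⟨ lookup-++ʳ (replicate p s) _ (k ↑ʳ i) ⟩
    lookup (replicate k m ++ replicate p l) (k ↑ʳ i)     ≡⟨ lookup-++ʳ (replicate k m) _ i ⟩
    lookup (replicate p l) i                             ≡⟨ lookup-replicate i l ⟩
    l                                                    ∎
    where open ≡-Reasoning

  flagged⇒∈ : ∀ {s m l} x → flag s m l x ≡ inside → encode x ∈ blocks s m l
  flagged⇒∈ {s} {m} {l} x e = lookup⇒[]= (encode x) (blocks s m l) (trans (lookup-blocks s m l x) e)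

  ∈⇒flagged : ∀ {s m l} x → encode x ∈ blocks s m l → flag s m l x ≡ inside
  ∈⇒flagged {s} {m} {l} x x∈ = trans (≡-sym (lookup-blocks s m l x)) ([]=⇒lookup x∈)

  unflagged⇒∉ : ∀ {s m l} x → flag s m l x ≡ outside → encode x ∉ blocks s m l
  unflagged⇒∉ x e x∈ with () ← trans (≡-sym e) (∈⇒flagged x x∈)

  spineSet coreSet : Subset N
  spineSet = blocks inside outside outside
  coreSet  = blocks inside inside outside

  spine∈ : ∀ {m l} i → encode (spine i) ∈ blocks inside m l
  spine∈ i = flagged⇒∈ (spine i) refl

  ∈spineSet⇒spine : ∀ v → v ∈ spineSet → ∃[ i ] (v ≡ encode (spine i))
  ∈spineSet⇒spine = vertex-ind _ λ
    { (spine i) _   → i , refl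
    ; (mid j)   v∈  → ⊥-elim (unflagged⇒∉ (mid j) refl v∈)
    ; (leaf i)  v∈  → ⊥-elim (unflagged⇒∉ (leaf i) refl v∈) }

  ∉coreSet⇒leaf : ∀ v → v ∉ coreSet → ∃[ i ] (v ≡ encode (leaf i))
  ∉coreSet⇒leaf = vertex-ind _ λ
    { (spine i) v∉ → ⊥-elim (v∉ (spine∈ i))
    ; (mid j)   v∉ → ⊥-elim (v∉ (flagged⇒∈ (mid j) refl))
    ; (leaf i)  _  → i , refl }

  leaf-hasAtMostOneNeighbour : ∀ i → HasAtMostOneNeighbour G (encode (leaf i))
  leaf-hasAtMostOneNeighbour i {u} {w} ui wi = trans (toSpine u ui) (≡-sym (toSpine w wi))
    where
    toSpine : ∀ v → Adj G v (encode (leaf i)) → v ≡ encode (spine i)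
    toSpine = vertex-ind _ λ x xi → cong encode (leaf-neighbour (adj⇒edge {x} xi))

  spine-dominates : ∀ {m l} → Dominating G (blocks inside m l)
  spine-dominates = vertex-ind _ λ
    { (spine i) → inj₁ (spine∈ i)
    ; (mid j)   → inj₂ (_ , spine∈ (hi j) , edge⇒adj (inj₂ (mid-spine refl)))
    ; (leaf i)  → inj₂ (_ , spine∈ i , edge⇒adj (inj₁ spine-leaf)) }

  spineSet-inducesConnected : InducesConnected G spineSet
  spineSet-inducesConnected a b a∈ b∈ with ∈spineSet⇒spine a a∈ | ∈spineSet⇒spine b b∈
  ... | i , refl | j , refl = reachable-trans (spine-path spine∈ i) (reachable-sym (spine-path spine∈ j))

  spineSet-connectedDominating : ConnectedDominating G spineSet
  spineSet-connectedDominating = spine-dominates , spineSet-inducesConnected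

  connected : Connected G
  connected = connectedDominating⇒connected (spine∈ fzero) spineSet-connectedDominating

  coreSet-weaklyConvexDominating : WeaklyConvexDominating G coreSet
  coreSet-weaklyConvexDominating = spine-dominates ,
    shortcuts⇒weaklyConvex connected (pendantComplement⇒shortcuts pendant)
    where
    pendant : ∀ {v} → v ∉ coreSet → HasAtMostOneNeighbour G v
    pendant {v} v∉ with ∉coreSet⇒leaf v v∉
    ... | i , refl = leaf-hasAtMostOneNeighbour i

  spine-∈-connectedDominating : ∀ {D} → ConnectedDominating G D → ∀ i → encode (spine i) ∈ D
  spine-∈-connectedDominating {D} cd@(dom , _) i =
    let (u , u∈ , u≢leaf) = anotherVertex in
    support-∈ (edge⇒adj (inj₁ spine-leaf)) (leaf-hasAtMostOneNeighbour i) cd u∈ u≢leaf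
    where
    other : Fin p → Fin p
    other fzero    = fsuc fzero
    other (fsuc _) = fzero

    other≢ : ∀ i → leaf (other i) ≢ leaf i
    other≢ fzero    ()
    other≢ (fsuc _) ()

    -- D dominates the leaf at other i by a vertex that cannot be leaf i.
    anotherVertex : ∃[ u ] (u ∈ D × u ≢ encode (leaf i))
    anotherVertex with dom (encode (leaf (other i)))
    ... | inj₁ l∈            = _ , l∈ , other≢ i ∘ encode-injective
    ... | inj₂ (u , u∈ , ul) = u , u∈ , λ e →
      leaf≁leaf (adj⇒edge {leaf i} (subst (λ w → Adj G w (encode (leaf (other i)))) e ul))

  mid-∈-weaklyConvex : ∀ {X} → WeaklyConvex G X → (∀ i → encode (spine i) ∈ X) → ∀ j → encode (mid j) ∈ X
  mid-∈-weaklyConvex {X} wc spine∈X j =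
    let (c , c∈ , ac , cb) = midpoint-∈ (spine-3apart-≢ (hi≡3+lo j) ∘ encode-injective)
                                        (spine-3apart-≁ (hi≡3+lo j) ∘ adj⇒edge) walk₂ wc
                                        (spine∈X (lo j)) (spine∈X (hi j))
    in subst (_∈ X) (onlyCommonNeighbour c ac cb) c∈
    where
    walk₂ : Walk G (encode (spine (lo j))) (encode (spine (hi j))) 2
    walk₂ = step {b = encode (mid j)} fzero
                 (edge⇒adj {spine (lo j)} {mid j} (inj₁ (spine-mid (toℕ-inject≤ j _))))
              (step {b = encode (spine (hi j))} fzero
                 (edge⇒adj {mid j} {spine (hi j)} (inj₁ (mid-spine refl)))
              (here fzero))

    onlyCommonNeighbour : ∀ c → Adj G (encode (spine (lo j))) c → Adj G c (encode (spine (hi j))) →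
                          c ≡ encode (mid j)
    onlyCommonNeighbour = vertex-ind _ λ x ac cb →
      let (j′ , x≡mid , lo≡j′) =
            spine-3apart-commonNeighbour (hi≡3+lo j) (adj⇒edge {spine (lo j)} ac) (adj⇒edge {x} cb)
      in cong encode (trans x≡mid (cong mid (toℕ-injective (trans (≡-sym lo≡j′) (toℕ-inject≤ j _)))))

  spineSet⊆connectedDominating : ∀ D → ConnectedDominating G D → spineSet ⊆ D
  spineSet⊆connectedDominating D cd {v} v∈ with ∈spineSet⇒spine v v∈
  ... | i , refl = spine-∈-connectedDominating cd i

  coreSet⊆weaklyConvexDominating : ∀ D → WeaklyConvexDominating G D → coreSet ⊆ D
  coreSet⊆weaklyConvexDominating D (dom , wc) {v} = vertex-ind (λ v → v ∈ coreSet → v ∈ D) core⊆D v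
    where
    spine∈D : ∀ i → encode (spine i) ∈ D
    spine∈D = spine-∈-connectedDominating (dom , weaklyConvex⇒inducesConnected wc)

    core⊆D : ∀ x → encode x ∈ coreSet → encode x ∈ D
    core⊆D (spine i) _  = spine∈D i
    core⊆D (mid j)   _  = mid-∈-weaklyConvex wc spine∈D j
    core⊆D (leaf i)  x∈ = ⊥-elim (unflagged⇒∉ (leaf i) refl x∈)

  ∣spineSet∣ : ∣ spineSet ∣ ≡ p
  ∣spineSet∣ = begin
    ∣ spineSet ∣                                         ≡⟨ ∣⊤++q∣ p _ ⟩
    p + ∣ replicate k outside ++ replicate p outside ∣   ≡⟨ cong (p +_) (trans (∣⊥++q∣ k _) (∣⊥∣≡0 p)) ⟩
    p + 0                                                ≡⟨ +-identityʳ p ⟩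
    p                                                    ∎
    where open ≡-Reasoning

  ∣coreSet∣ : ∣ coreSet ∣ ≡ p + k
  ∣coreSet∣ = begin
    ∣ coreSet ∣                                          ≡⟨ ∣⊤++q∣ p _ ⟩
    p + ∣ replicate k inside ++ replicate p outside ∣    ≡⟨ cong (p +_) (∣⊤++q∣ k _) ⟩
    p + (k + ∣ replicate p outside ∣)                    ≡⟨ cong (λ c → p + (k + c)) (∣⊥∣≡0 p) ⟩
    p + (k + 0)                                          ≡⟨ cong (p +_) (+-identityʳ k) ⟩
    p + k                                                ∎
    where open ≡-Reasoning

-- The construction works for every k.
theorem2p1 : ∀ (k : ℕ) → 6 ≤ k →
    ∃[ G ] (Connected G × ∃[ c ] ∃[ w ]
      (IsConnDomNumber G c × IsWeaklyConvexDomNumber G w × w ≡ c + k))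
theorem2p1 k _ =
  G , connected , ∣ spineSet ∣ , ∣ coreSet ∣ ,
  least⇒isMinCard {G = G} spineSet-connectedDominating spineSet⊆connectedDominating ,
  least⇒isMinCard {G = G} coreSet-weaklyConvexDominating coreSet⊆weaklyConvexDominating ,
  trans ∣coreSet∣ (cong (_+ k) (≡-sym ∣spineSet∣))
  where open Construction k
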